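{- Let $G=(V,E)$ be a finite graph, $A,B\subseteq V^2$, $e\in E$ an edge, and $\phi$ a fourientation of $G\setminus e$. Let $c$ be one of the two 1-way configurations of $e$ and suppose that $\phi\cup c$ is $(A,B)$-valid. If the arc $c$ is cyclic in $D(c)$, then $\phi\cup \bar e_2$ is $(A,B)$-valid, where $\bar e_2$ is the 2-way configuration of $e$. If the arc $c$ is acyclic in $D(c)$, then $\phi\cup\bar e_0$ is $(A,B)$-valid, where $\bar e_0$ is the 0-way configuration of $e$.
   Context: A fourientation assigns to each edge one of four configurations: 0-way, 2-way, or one of two 1-way configurations; its digraph has two opposite arcs per 2-way edge, one arc per 1-way edge in its allowed direction, no arc for 0-way edges. For a configuration $c$ of $e$, $\phi\cup c$ is the fourientation of $G$ extending $\phi$ with $e$ in configuration $c$, and $D(c)$ is the digraph of $\phi\cup c$ with an arc from $u$ to $v$ added for every $(u,v)\in A$ and every $(u,v)\in B$. An arc $(x,y)$ is cyclic if there is a directed path from $y$ to $x$, acyclic otherwise. A fourientation $\psi$ of $G$ is $(A,B)$-valid if, in the digraph of $\psi$ with these arcs of $A$ and $B$ added, every arc from $A$ is acyclic and every arc from $B$ is cyclic. -}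

module Defs where

open import Level using (0ℓ)
open import Data.Nat using (ℕ)
open import Data.Fin using (Fin; _≟_)
open import Data.Product using (_×_; _,_; ∃)
open import Data.Sum using (_⊎_)
open import Relation.Nullary using (¬_; yes; no)
open import Relation.Unary using (Pred; _∈_)
open import Relation.Binary.PropositionalEquality using (_≡_)
open import Relation.Binary.Construct.Closure.ReflexiveTransitive using (Star)

-- A finite (multi)graph: vertices Fin nV, edges Fin nE; each edge has a
-- fixed reference ordering of its endpoints (tail , head).  Loops and
-- parallel edges are allowed.
record Graph : Set where
  field
    nV   : ℕ
    nE   : ℕ
    ends : Fin nE → Fin nV × Fin nV

open Graph public

V : Graph → Set
V G = Fin (nV G)

E : Graph → Set
E G = Fin (nE G)

data Dir : Set where
  fwd bwd : Dir

data Config : Set where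
  zeroWay : Config
  twoWay  : Config
  oneWay  : Dir → Config

Fourientation : Graph → Set
Fourientation G = E G → Config

-- φ ∪ c : set edge e to configuration c (the value of φ at e is ignored,
-- so φ plays the role of a fourientation of G ∖ e).
extend : (G : Graph) → Fourientation G → E G → Config → Fourientation G
extend G φ e c f with f ≟ e
... | yes _ = c
... | no  _ = φ f

arcOf : (G : Graph) → E G → Dir → V G × V G
arcOf G e fwd with ends G e
... | (u , v) = (u , v)
arcOf G e bwd with ends G e
... | (u , v) = (v , u)

data Arc (G : Graph) (A B : Pred (V G × V G) 0ℓ) (ψ : Fourientation G)
         : V G → V G → Set where
  arc-two₁ : ∀ {u v} (f : E G) → ψ f ≡ twoWay → ends G f ≡ (u , v) → Arc G A B ψ u v
  arc-two₂ : ∀ {u v} (f : E G) → ψ f ≡ twoWay → ends G f ≡ (v , u) → Arc G A B ψ u v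
  arc-one  : ∀ {u v} (f : E G) (d : Dir) → ψ f ≡ oneWay d → arcOf G f d ≡ (u , v) → Arc G A B ψ u v
  arc-A    : ∀ {u v} → (u , v) ∈ A → Arc G A B ψ u v
  arc-B    : ∀ {u v} → (u , v) ∈ B → Arc G A B ψ u v

-- An arc (x , y) is cyclic if there is a directed path (possibly of
-- length 0) from y to x.
Cyclic : (G : Graph) (A B : Pred (V G × V G) 0ℓ) → Fourientation G → V G × V G → Set
Cyclic G A B ψ (x , y) = Star (Arc G A B ψ) y x

Acyclic : (G : Graph) (A B : Pred (V G × V G) 0ℓ) → Fourientation G → V G × V G → Set
Acyclic G A B ψ a = ¬ Cyclic G A B ψ a

Valid : (G : Graph) (A B : Pred (V G × V G) 0ℓ) → Fourientation G → Set
Valid G A B ψ =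
  (∀ a → a ∈ A → Acyclic G A B ψ a) × (∀ b → b ∈ B → Cyclic G A B ψ b)

-- Passing from the 1-way configuration c of e to 2-way only adds the reverse
-- arc of c; if c is cyclic, that arc is already realised by a directed path, so
-- the reachability relation, and with it validity, is unchanged.  Passing to
-- 0-way only deletes c: acyclic arcs stay acyclic, and a cycle through a B-arc
-- that used c would, rerouted through that B-arc, close a cycle through c.
module Submission where

open import Defs
open import Level using (0ℓ)
open import Data.Empty using (⊥-elim)
open import Data.Fin using (_≟_)
open import Data.Product using (_×_; _,_; proj₁; proj₂; swap)
open import Data.Sum using (_⊎_; inj₁; inj₂; [_,_]′)
open import Function using (_∘_; case_of_)
open import Relation.Nullary using (¬_; yes; no)
open import Relation.Unary using (Pred; _∈_)
open import Relation.Binary using (Rel; _⇒_)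
open import Relation.Binary.PropositionalEquality using (_≡_; _≢_; refl; sym; trans; cong; subst)
open import Relation.Binary.Construct.Closure.ReflexiveTransitive
  using (Star; ε; _◅_; _◅◅_; return; _⋆)

Star-avoid-or-cross : ∀ {I : Set} {R S : Rel I 0ℓ} {a : I × I} →
  (∀ {u v} → R u v → S u v ⊎ (u , v) ≡ a) →
  ∀ {u v} → Star R u v → Star S u v ⊎ (Star R u (proj₁ a) × Star R (proj₂ a) v)
Star-avoid-or-cross split ε = inj₁ ε
Star-avoid-or-cross split (r ◅ rs) with split r | Star-avoid-or-cross split rs
... | inj₂ refl | _            = inj₂ (ε , rs)
... | inj₁ s    | inj₁ ss      = inj₁ (s ◅ ss)
... | inj₁ _    | inj₂ (p , q) = inj₂ (r ◅ p , q)

module _ (G : Graph) where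

  arcOf-fwd : ∀ f → arcOf G f fwd ≡ ends G f
  arcOf-fwd f with ends G f
  ... | _ , _ = refl

  arcOf-bwd : ∀ f → arcOf G f bwd ≡ swap (ends G f)
  arcOf-bwd f with ends G f
  ... | _ , _ = refl

  data Carries (f : E G) : Config → V G → V G → Set where
    carries-twoWay : ∀ d {u v} → arcOf G f d ≡ (u , v) → Carries f twoWay u v
    carries-oneWay : ∀ d {u v} → arcOf G f d ≡ (u , v) → Carries f (oneWay d) u v

  ¬Carries-zeroWay : ∀ {f u v} → ¬ Carries f zeroWay u v
  ¬Carries-zeroWay ()

  Carries-oneWay⇒twoWay : ∀ {f d u v} → Carries f (oneWay d) u v → Carries f twoWay u v
  Carries-oneWay⇒twoWay (carries-oneWay d eq) = carries-twoWay d eq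

  Carries-oneWay-inv : ∀ {f d u v} → Carries f (oneWay d) u v → arcOf G f d ≡ (u , v)
  Carries-oneWay-inv (carries-oneWay _ eq) = eq

  Carries-twoWay-inv : ∀ {f u v} (d : Dir) → Carries f twoWay u v →
    Carries f (oneWay d) u v ⊎ arcOf G f d ≡ (v , u)
  Carries-twoWay-inv fwd (carries-twoWay fwd eq) = inj₁ (carries-oneWay fwd eq)
  Carries-twoWay-inv bwd (carries-twoWay bwd eq) = inj₁ (carries-oneWay bwd eq)
  Carries-twoWay-inv {f} fwd (carries-twoWay bwd eq) =
    inj₂ (trans (arcOf-fwd f) (cong swap (trans (sym (arcOf-bwd f)) eq)))
  Carries-twoWay-inv {f} bwd (carries-twoWay fwd eq) =
    inj₂ (trans (arcOf-bwd f) (cong swap (trans (sym (arcOf-fwd f)) eq)))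

  module _ (A B : Pred (V G × V G) 0ℓ) where

    Arc-carried : ∀ {ψ f c u v} → ψ f ≡ c → Carries f c u v → Arc G A B ψ u v
    Arc-carried {f = f} ψf≡2 (carries-twoWay fwd eq) =
      arc-two₁ f ψf≡2 (trans (sym (arcOf-fwd f)) eq)
    Arc-carried {f = f} ψf≡2 (carries-twoWay bwd eq) =
      arc-two₂ f ψf≡2 (cong swap (trans (sym (arcOf-bwd f)) eq))
    Arc-carried {f = f} ψf≡1 (carries-oneWay d eq) = arc-one f d ψf≡1 eq

    Arc-elim : ∀ {ψ} {R : Rel (V G) 0ℓ} →
      (∀ f {u v} → Carries f (ψ f) u v → R u v) →
      (∀ {u v} → (u , v) ∈ A → R u v) →
      (∀ {u v} → (u , v) ∈ B → R u v) →
      Arc G A B ψ ⇒ R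
    Arc-elim {ψ} {R} edge onA onB = elim
      where
      carried : ∀ f {c u v} → ψ f ≡ c → Carries f c u v → R u v
      carried f ψf≡c = edge f ∘ subst (λ c → Carries f c _ _) (sym ψf≡c)

      elim : Arc G A B ψ ⇒ R
      elim (arc-two₁ f ψf≡2 en) =
        carried f ψf≡2 (carries-twoWay fwd (trans (arcOf-fwd f) en))
      elim (arc-two₂ f ψf≡2 en) =
        carried f ψf≡2 (carries-twoWay bwd (trans (arcOf-bwd f) (cong swap en)))
      elim (arc-one f d ψf≡1 eq) = carried f ψf≡1 (carries-oneWay d eq)
      elim (arc-A h) = onA h
      elim (arc-B h) = onB h

    Cyclic-mono : ∀ {ψ ψ′} → Arc G A B ψ ⇒ Star (Arc G A B ψ′) →
      ∀ a → Cyclic G A B ψ a → Cyclic G A B ψ′ a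
    Cyclic-mono sub _ = sub ⋆

    Valid-transfer : ∀ {ψ ψ′} →
      Arc G A B ψ ⇒ Star (Arc G A B ψ′) → Arc G A B ψ′ ⇒ Star (Arc G A B ψ) →
      Valid G A B ψ → Valid G A B ψ′
    Valid-transfer sub sub′ (acyclicA , cyclicB) =
        (λ a a∈A → acyclicA a a∈A ∘ Cyclic-mono sub′ a)
      , (λ b b∈B → Cyclic-mono sub b (cyclicB b b∈B))

    module _ (φ : Fourientation G) (e : E G) where

      extend-at : ∀ c → extend G φ e c e ≡ c
      extend-at c with e ≟ e
      ... | yes _  = refl
      ... | no e≢e = ⊥-elim (e≢e refl)

      extend-away : ∀ {f} → f ≢ e → ∀ c c′ → extend G φ e c f ≡ extend G φ e c′ f
      extend-away {f} f≢e c c′ with f ≟ e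
      ... | yes f≡e = ⊥-elim (f≢e f≡e)
      ... | no  _   = refl

      private
        Arcs : Config → Rel (V G) 0ℓ
        Arcs c = Arc G A B (extend G φ e c)

        carried-away : ∀ {f} → f ≢ e → ∀ {c c′ u v} →
          Carries f (extend G φ e c f) u v → Arcs c′ u v
        carried-away f≢e {c} {c′} =
          Arc-carried (extend-away f≢e c′ c)

      Arc-extend-carried : ∀ {c} → Carries e c ⇒ Arcs c
      Arc-extend-carried {c} = Arc-carried (extend-at c)

      Arc-extend-zeroWay : ∀ {c} → Arcs zeroWay ⇒ Arcs c
      Arc-extend-zeroWay {c} = Arc-elim edge arc-A arc-B
        where
        edge : ∀ f {u v} → Carries f (extend G φ e zeroWay f) u v → Arcs c u v
        edge f carried = case f ≟ e of λ where
          (no f≢e)   → carried-away f≢e carried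
          (yes refl) → ⊥-elim (¬Carries-zeroWay
                         (subst (λ c → Carries e c _ _) (extend-at zeroWay) carried))

      Arc-extend-split : ∀ {c} → Arcs c ⇒ (λ u v → Arcs zeroWay u v ⊎ Carries e c u v)
      Arc-extend-split {c} = Arc-elim edge (inj₁ ∘ arc-A) (inj₁ ∘ arc-B)
        where
        edge : ∀ f {u v} → Carries f (extend G φ e c f) u v →
          Arcs zeroWay u v ⊎ Carries e c u v
        edge f carried = case f ≟ e of λ where
          (no f≢e)   → inj₁ (carried-away f≢e carried)
          (yes refl) → inj₂ (subst (λ c → Carries e c _ _) (extend-at c) carried)

      module _ (d : Dir) where

        private
          ψ₁ : Fourientation G
          ψ₁ = extend G φ e (oneWay d)

        Arc-oneWay⇒twoWay : Arcs (oneWay d) ⇒ Arcs twoWay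
        Arc-oneWay⇒twoWay =
          [ Arc-extend-zeroWay , Arc-extend-carried ∘ Carries-oneWay⇒twoWay ]′ ∘ Arc-extend-split

        Arc-twoWay⇒reachable : Cyclic G A B ψ₁ (arcOf G e d) →
          Arcs twoWay ⇒ Star (Arcs (oneWay d))
        Arc-twoWay⇒reachable cyc =
          [ return ∘ Arc-extend-zeroWay
          , [ return ∘ Arc-extend-carried , (λ reversed → subst (Cyclic G A B ψ₁) reversed cyc) ]′
            ∘ Carries-twoWay-inv d
          ]′ ∘ Arc-extend-split

        Arc-oneWay-split : ∀ {u v} → Arcs (oneWay d) u v →
          Arcs zeroWay u v ⊎ (u , v) ≡ arcOf G e d
        Arc-oneWay-split = [ inj₁ , inj₂ ∘ sym ∘ Carries-oneWay-inv ]′ ∘ Arc-extend-split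

        Valid-twoWay : Valid G A B ψ₁ → Cyclic G A B ψ₁ (arcOf G e d) →
          Valid G A B (extend G φ e twoWay)
        Valid-twoWay valid cyc =
          Valid-transfer (return ∘ Arc-oneWay⇒twoWay) (Arc-twoWay⇒reachable cyc) valid

        Valid-zeroWay : Valid G A B ψ₁ → Acyclic G A B ψ₁ (arcOf G e d) →
          Valid G A B (extend G φ e zeroWay)
        Valid-zeroWay (acyclicA , cyclicB) acyc =
            (λ a a∈A → acyclicA a a∈A ∘ Cyclic-mono (return ∘ Arc-extend-zeroWay) a)
          , cycle-avoids
          where
          cycle-avoids : ∀ b → b ∈ B → Cyclic G A B (extend G φ e zeroWay) b
          cycle-avoids b b∈B with Star-avoid-or-cross Arc-oneWay-split (cyclicB b b∈B)
          ... | inj₁ path    = path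
          ... | inj₂ (p , q) = ⊥-elim (acyc (q ◅◅ arc-B b∈B ◅ p))

lemma3p9 : (G : Graph) (A B : Pred (V G × V G) 0ℓ) (e : E G)
    (φ : Fourientation G) (d : Dir) →
    Valid G A B (extend G φ e (oneWay d)) →
    (Cyclic G A B (extend G φ e (oneWay d)) (arcOf G e d) →
      Valid G A B (extend G φ e twoWay))
    × (Acyclic G A B (extend G φ e (oneWay d)) (arcOf G e d) →
      Valid G A B (extend G φ e zeroWay))
lemma3p9 G A B e φ d valid =
  Valid-twoWay G A B φ e d valid , Valid-zeroWay G A B φ e d valid
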